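{- For every integer $\ell\ge 8$ not divisible by $3$, the tight cycle $C_\ell^3$ is a subgraph of some blowup of $C_4^3$ and of some blowup of $C_5^3$. Also, $C_7^3$ is a subgraph of some blowup of each of $C_4^3$, $F_1$ and $F_2$.
   Context: For $\ell\ge4$, $C_\ell^3$ is the $3$-graph on $\{1,\dots,\ell\}$ with edges the cyclically consecutive triples $\{i,i+1,i+2\}$ (indices mod $\ell$); $C_4^3$ is the complete $3$-graph on $4$ vertices. $F_1$ is the $3$-graph on $\{1,\dots,5\}$ with edges $\{1,2,3\},\{1,3,4\},\{1,4,2\},\{1,4,5\},\{2,3,4\}$, and $F_2$ is the $3$-graph on $\{1,\dots,6\}$ with edges $\{1,2,3\},\{1,3,4\},\{1,4,5\},\{1,5,6\},\{1,6,2\},\{2,3,4\}$. For an integer $m\ge1$, the $m$-blowup of a $3$-graph $\mathcal{H}$ has vertex set a disjoint union of $m$-sets $U_v$, $v\in V(\mathcal{H})$, and edge set the union over all edges $\{x,y,z\}\in\mathcal{H}$ of all triples with one vertex in each of $U_x,U_y,U_z$. -}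

module Defs where

open import Data.Nat using (ℕ; zero; suc; _+_; _≤_)
open import Data.Nat.DivMod using (_mod_)
open import Data.Fin using (Fin; toℕ; #_)
open import Data.Product using (Σ; ∃; _×_; _,_; proj₁)
open import Data.Sum using (_⊎_)
open import Data.List using (List; []; _∷_)
open import Data.List.Relation.Unary.Any using (Any)
open import Relation.Binary.PropositionalEquality using (_≡_)
open import Function.Definitions using (Injective)

-- A 3-graph: a vertex type together with an edge predicate on ordered
-- triples; E x y z means that {x,y,z} is an edge (E is symmetric by construction
-- in all instances below, and only holds for three distinct vertices).
record Graph3 : Set₁ where
  field
    V : Set
    E : V → V → V → Set
open Graph3 public

SameTriple : {A : Set} → A × A × A → A × A × A → Set
SameTriple (a , b , c) (x , y , z) =
     ((x , y , z) ≡ (a , b , c))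
   ⊎ ((x , y , z) ≡ (a , c , b))
   ⊎ ((x , y , z) ≡ (b , a , c))
   ⊎ ((x , y , z) ≡ (b , c , a))
   ⊎ ((x , y , z) ≡ (c , a , b))
   ⊎ ((x , y , z) ≡ (c , b , a))

fromList : (n : ℕ) → List (Fin n × Fin n × Fin n) → Graph3
fromList n es = record
  { V = Fin n
  ; E = λ x y z → Any (λ e → SameTriple e (x , y , z)) es }

-- Tight cycle C_ℓ^3 on vertices 0,…,ℓ-1, edges {i,i+1,i+2} (mod ℓ).
-- (Only used for ℓ ≥ 4; for ℓ = 0 it is the empty graph.)
TightCycle : ℕ → Graph3
TightCycle zero = record { V = Fin zero ; E = λ _ _ _ → Fin zero }
TightCycle (suc k) = record
  { V = Fin (suc k)
  ; E = λ x y z → Σ (Fin (suc k)) λ i →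
          SameTriple ( (toℕ i) mod (suc k)
                     , (toℕ i + 1) mod (suc k)
                     , (toℕ i + 2) mod (suc k) ) (x , y , z) }

-- F₁ on {1,…,5} (written 0,…,4): 123,134,142,145,234.
F₁ : Graph3
F₁ = fromList 5
  ( (# 0 , # 1 , # 2) ∷ (# 0 , # 2 , # 3) ∷ (# 0 , # 3 , # 1) ∷ (# 0 , # 3 , # 4) ∷ (# 1 , # 2 , # 3) ∷ [] )

-- F₂ on {1,…,6} (written 0,…,5): 123,134,145,156,162,234.
F₂ : Graph3
F₂ = fromList 6
  ( (# 0 , # 1 , # 2) ∷ (# 0 , # 2 , # 3) ∷ (# 0 , # 3 , # 4) ∷ (# 0 , # 4 , # 5) ∷ (# 0 , # 5 , # 1) ∷ (# 1 , # 2 , # 3) ∷ [] )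

-- m-blowup: U_v = {v} × Fin m; a triple is an edge iff its three vertices lie
-- in U_x, U_y, U_z for an edge {x,y,z} of H.
Blowup : ℕ → Graph3 → Graph3
Blowup m H = record
  { V = V H × Fin m
  ; E = λ p q r → E H (proj₁ p) (proj₁ q) (proj₁ r) }

_⊆_ : Graph3 → Graph3 → Set
G ⊆ H = Σ (V G → V H) λ f →
  Injective _≡_ _≡_ f × (∀ x y z → E G x y z → E H (f x) (f y) (f z))

InSomeBlowup : Graph3 → Graph3 → Set
InSomeBlowup G H = Σ ℕ λ m → (1 ≤ m) × (G ⊆ Blowup m H)

{-# OPTIONS --safe #-}
module Submission where

open import Defs
open import Data.Nat using (ℕ; zero; suc; _+_; _*_; _≤_; _<_; _%_; s≤s; z≤n)
open import Data.Nat.Properties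
  using (m≤n⇒m<n∨m≡n; m≤n⇒∃[o]m+o≡n; ≤-pred; ≤-trans; +-comm; m≤m+n; n≤1+n; +-monoʳ-≤)
open import Data.Nat.DivMod using (_mod_; m%n<n; m<n⇒m%n≡m; n%n≡0; [m+n]%n≡m%n)
open import Data.Nat.Divisibility using (_∣_; divides; ∣-refl; ∣m∣n⇒∣m+n)
open import Data.Fin using (Fin; toℕ; #_; _≟_)
open import Data.Fin.Properties using (toℕ-fromℕ<; toℕ<n)
open import Data.Product using (Σ; ∃-syntax; _×_; _,_; proj₁; proj₂)
open import Data.Product.Properties using (≡-dec)
open import Data.Sum using (_⊎_; inj₁; inj₂)
open import Data.Empty using (⊥-elim)
open import Data.List using (List)
import Data.List.Relation.Unary.Any as Any
open import Function using (id)
open import Function.Definitions using (Injective)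
open import Relation.Binary.Definitions using (DecidableEquality)
open import Relation.Binary.PropositionalEquality using (_≡_; refl; sym; trans; cong; subst; module ≡-Reasoning)
open import Relation.Nullary using (¬_; Dec)
open import Relation.Nullary.Decidable using (True; toWitness; _⊎-dec_)

-- A closed tight walk of length ℓ in H (a cyclic word of ℓ vertices whose cyclically
-- consecutive triples are edges of H) is a homomorphism C_ℓ³ → H, and a homomorphism from
-- an ℓ-vertex graph embeds it in the ℓ-blowup of H, the blowup coordinate separating the
-- vertices. Closed walks at the same starting pair concatenate, and every edge xyz gives the
-- closed walk xyz of length 3. In C₄³ and C₅³ going once around gives lengths 4 and 5, so
-- lengths 8 + 3b and 10 + 3b, i.e. all ℓ ≥ 8 with 3 ∤ ℓ, occur. For C₇³: 0123·012 in C₄³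
-- and in F₁ (which contains a K₄³), and 0123045 in F₂.

pattern abc = inj₁ refl
pattern acb = inj₂ (inj₁ refl)
pattern bac = inj₂ (inj₂ (inj₁ refl))
pattern bca = inj₂ (inj₂ (inj₂ (inj₁ refl)))
pattern cab = inj₂ (inj₂ (inj₂ (inj₂ (inj₁ refl))))
pattern cba = inj₂ (inj₂ (inj₂ (inj₂ (inj₂ refl))))

module _ {A : Set} {t : A × A × A} where

  SameTriple-swap₁₂ : ∀ {x y z} → SameTriple t (x , y , z) → SameTriple t (y , x , z)
  SameTriple-swap₁₂ abc = bac
  SameTriple-swap₁₂ acb = cab
  SameTriple-swap₁₂ bac = abc
  SameTriple-swap₁₂ bca = cba
  SameTriple-swap₁₂ cab = acb
  SameTriple-swap₁₂ cba = bca

  SameTriple-swap₂₃ : ∀ {x y z} → SameTriple t (x , y , z) → SameTriple t (x , z , y)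
  SameTriple-swap₂₃ abc = acb
  SameTriple-swap₂₃ acb = abc
  SameTriple-swap₂₃ bac = bca
  SameTriple-swap₂₃ bca = bac
  SameTriple-swap₂₃ cab = cba
  SameTriple-swap₂₃ cba = cab

  SameTriple-trans : ∀ {u v} → SameTriple t u → SameTriple u v → SameTriple t v
  SameTriple-trans s abc = s
  SameTriple-trans s acb = SameTriple-swap₂₃ s
  SameTriple-trans s bac = SameTriple-swap₁₂ s
  SameTriple-trans s bca = SameTriple-swap₂₃ (SameTriple-swap₁₂ s)
  SameTriple-trans s cab = SameTriple-swap₁₂ (SameTriple-swap₂₃ s)
  SameTriple-trans s cba = SameTriple-swap₁₂ (SameTriple-swap₂₃ (SameTriple-swap₁₂ s))

SameTriple-map : ∀ {A B : Set} (f : A → B) {a b c x y z : A} →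
                 SameTriple (a , b , c) (x , y , z) → SameTriple (f a , f b , f c) (f x , f y , f z)
SameTriple-map f abc = abc
SameTriple-map f acb = acb
SameTriple-map f bac = bac
SameTriple-map f bca = bca
SameTriple-map f cab = cab
SameTriple-map f cba = cba

sameTriple? : ∀ {A : Set} → DecidableEquality A → (t u : A × A × A) → Dec (SameTriple t u)
sameTriple? {A} _≟ₐ_ (a , b , c) u =
  u ≟₃ (a , b , c) ⊎-dec u ≟₃ (a , c , b) ⊎-dec u ≟₃ (b , a , c) ⊎-dec
  u ≟₃ (b , c , a) ⊎-dec u ≟₃ (c , a , b) ⊎-dec u ≟₃ (c , b , a)
  where
  _≟₃_ : DecidableEquality (A × A × A)
  _≟₃_ = ≡-dec _≟ₐ_ (≡-dec _≟ₐ_ _≟ₐ_)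

PermutationClosed : Graph3 → Set
PermutationClosed H = ∀ {a b c x y z} → SameTriple (a , b , c) (x , y , z) → E H a b c → E H x y z

fromList-permutationClosed : ∀ n es → PermutationClosed (fromList n es)
fromList-permutationClosed n es s = Any.map (λ t → SameTriple-trans t s)

tightCycle-permutationClosed : ∀ k → PermutationClosed (TightCycle (suc k))
tightCycle-permutationClosed k s (i , t) = i , SameTriple-trans t s

tightCycle-window : ∀ {k} (i : Fin (suc k)) →
  E (TightCycle (suc k)) (toℕ i mod suc k) ((toℕ i + 1) mod suc k) ((toℕ i + 2) mod suc k)
tightCycle-window i = i , abc

fromList-edge? : ∀ {n} (es : List (Fin n × Fin n × Fin n)) x y z → Dec (E (fromList n es) x y z)
fromList-edge? es x y z = Any.any? (λ e → sameTriple? _≟_ e (x , y , z)) es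

fromList-edge : ∀ {n} {es : List (Fin n × Fin n × Fin n)} x y z →
                {True (fromList-edge? es x y z)} → E (fromList n es) x y z
fromList-edge x y z {decided} = toWitness decided

Homomorphism : Graph3 → Graph3 → Set
Homomorphism G H = Σ (V G → V H) λ φ → ∀ x y z → E G x y z → E H (φ x) (φ y) (φ z)

homomorphism⇒⊆Blowup : ∀ {G H m} (ι : V G → Fin m) → Injective _≡_ _≡_ ι →
                        Homomorphism G H → G ⊆ Blowup m H
homomorphism⇒⊆Blowup ι ι-injective (φ , φ-edge) =
  (λ v → φ v , ι v) , (λ eq → ι-injective (cong proj₂ eq)) , φ-edge

-- Walk H (v₀ , v₁) (vₙ , vₙ₊₁) n : vertices v₀ … vₙ₊₁ whose consecutive triples are edges.
infixr 5 _∷_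

data Walk (H : Graph3) : V H × V H → V H × V H → ℕ → Set where
  []  : ∀ {p} → Walk H p p 0
  _∷_ : ∀ {x y z q n} → E H x y z → Walk H (y , z) q n → Walk H (x , y) q (suc n)

ClosedWalk : (H : Graph3) → V H × V H → ℕ → Set
ClosedWalk H p = Walk H p p

module _ {H : Graph3} where

  infixr 5 _++_

  _++_ : ∀ {p q r m n} → Walk H p q m → Walk H q r n → Walk H p r (m + n)
  []      ++ w′ = w′
  (e ∷ w) ++ w′ = e ∷ (w ++ w′)

  triangle : PermutationClosed H → ∀ {x y z} → E H x y z → ClosedWalk H (x , y) 3
  triangle closed e = e ∷ closed bca e ∷ closed cab e ∷ []

  prepend-triangles : ∀ {p ℓ} → ClosedWalk H p 3 → ClosedWalk H p ℓ → ∀ b → ClosedWalk H p (b * 3 + ℓ)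
  prepend-triangles t w zero    = w
  prepend-triangles t w (suc b) = t ++ prepend-triangles t w b

  vertex : ∀ {p q n} → Walk H p q n → ℕ → V H
  vertex {p = p} w       zero    = proj₁ p
  vertex {p = p} []      (suc _) = proj₂ p
  vertex         (_ ∷ w) (suc i) = vertex w i

  vertex-1 : ∀ {p q n} (w : Walk H p q n) → vertex w 1 ≡ proj₂ p
  vertex-1 []      = refl
  vertex-1 (_ ∷ _) = refl

  vertex-last : ∀ {p q n} (w : Walk H p q n) → vertex w n ≡ proj₁ q × vertex w (suc n) ≡ proj₂ q
  vertex-last []      = refl , refl
  vertex-last (_ ∷ w) = vertex-last w

  vertex-window : ∀ {p q n i} (w : Walk H p q n) → i < n →
                  E H (vertex w i) (vertex w (i + 1)) (vertex w (i + 2))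
  vertex-window {i = zero}  (e ∷ w) _ rewrite vertex-1 w = e
  vertex-window {i = suc i} (_ ∷ w) (s≤s i<n) = vertex-window w i<n

  -- ℓ = 2 + n ensures (ℓ + 1) % ℓ = 1.
  vertex-% : ∀ {p n} (w : ClosedWalk H p (2 + n)) m → m ≤ 3 + n → vertex w (m % (2 + n)) ≡ vertex w m
  vertex-% {p} {n} w m m≤ℓ+1 with m≤n⇒m<n∨m≡n m≤ℓ+1
  ... | inj₂ refl = begin
    vertex w ((1 + ℓ) % ℓ)  ≡⟨ cong (vertex w) ([m+n]%n≡m%n 1 ℓ) ⟩
    vertex w 1              ≡⟨ vertex-1 w ⟩
    proj₂ p                 ≡⟨ sym (proj₂ (vertex-last w)) ⟩
    vertex w (suc ℓ)        ∎
    where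
    open ≡-Reasoning
    ℓ : ℕ
    ℓ = 2 + n
  ... | inj₁ m<ℓ+1 with m≤n⇒m<n∨m≡n (≤-pred m<ℓ+1)
  ...   | inj₁ m<ℓ = cong (vertex w) (m<n⇒m%n≡m m<ℓ)
  ...   | inj₂ refl = trans (cong (vertex w) (n%n≡0 (2 + n))) (sym (proj₁ (vertex-last w)))

  vertex-mod : ∀ {p n} (w : ClosedWalk H p (2 + n)) m → m ≤ 3 + n →
               vertex w (toℕ (m mod (2 + n))) ≡ vertex w m
  vertex-mod {n = n} w m m≤ℓ+1 =
    trans (cong (vertex w) (toℕ-fromℕ< (m%n<n m (2 + n)))) (vertex-% w m m≤ℓ+1)

  closedWalk⇒homomorphism : PermutationClosed H → ∀ {p n} → ClosedWalk H p (2 + n) →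
                            Homomorphism (TightCycle (2 + n)) H
  closedWalk⇒homomorphism closed {n = n} w = φ , φ-edge
    where
    φ : Fin (2 + n) → V H
    φ v = vertex w (toℕ v)
    φ-edge : ∀ x y z → E (TightCycle (2 + n)) x y z → E H (φ x) (φ y) (φ z)
    φ-edge x y z (i , s) = closed (SameTriple-map φ s) window
      where
      i+2≤ℓ+1 : toℕ i + 2 ≤ 3 + n
      i+2≤ℓ+1 = subst (_≤ 3 + n) (+-comm 2 (toℕ i)) (s≤s (toℕ<n i))
      window : E H (φ (toℕ i mod (2 + n))) (φ ((toℕ i + 1) mod (2 + n))) (φ ((toℕ i + 2) mod (2 + n)))
      window
        rewrite vertex-mod w (toℕ i) (≤-trans (m≤m+n (toℕ i) 2) i+2≤ℓ+1)
              | vertex-mod w (toℕ i + 1) (≤-trans (+-monoʳ-≤ (toℕ i) (n≤1+n 1)) i+2≤ℓ+1)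
              | vertex-mod w (toℕ i + 2) i+2≤ℓ+1
        = vertex-window w (toℕ<n i)

  closedWalk⇒InSomeBlowup : PermutationClosed H → ∀ {p ℓ} → 2 ≤ ℓ → ClosedWalk H p ℓ →
                            InSomeBlowup (TightCycle ℓ) H
  closedWalk⇒InSomeBlowup closed {ℓ = ℓ} (s≤s (s≤s _)) w =
    ℓ , s≤s z≤n , homomorphism⇒⊆Blowup {H = H} id id (closedWalk⇒homomorphism closed w)

8≤ℓ∧3∤ℓ⇒ℓ≡b*3+8∨10 : ∀ {ℓ} → 8 ≤ ℓ → ¬ 3 ∣ ℓ → ∃[ b ] (ℓ ≡ b * 3 + 8 ⊎ ℓ ≡ b * 3 + 10)
8≤ℓ∧3∤ℓ⇒ℓ≡b*3+8∨10 8≤ℓ with m≤n⇒∃[o]m+o≡n 8≤ℓ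
... | n , refl = go n
  where
  go : ∀ n → ¬ 3 ∣ 8 + n → ∃[ b ] (8 + n ≡ b * 3 + 8 ⊎ 8 + n ≡ b * 3 + 10)
  go 0 _ = 0 , inj₁ refl
  go 1 3∤9 = ⊥-elim (3∤9 (divides 3 refl))
  go 2 _ = 0 , inj₂ refl
  go (suc (suc (suc n))) 3∤ℓ with go n (λ 3∣ → 3∤ℓ (∣m∣n⇒∣m+n (∣-refl {3}) 3∣))
  ... | b , inj₁ eq = suc b , inj₁ (cong (3 +_) eq)
  ... | b , inj₂ eq = suc b , inj₂ (cong (3 +_) eq)

closedWalk-≥8 : ∀ {H p} → ClosedWalk H p 3 → ClosedWalk H p 8 → ClosedWalk H p 10 →
                ∀ {ℓ} → 8 ≤ ℓ → ¬ 3 ∣ ℓ → ClosedWalk H p ℓ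
closedWalk-≥8 w₃ w₈ w₁₀ 8≤ℓ 3∤ℓ with 8≤ℓ∧3∤ℓ⇒ℓ≡b*3+8∨10 8≤ℓ 3∤ℓ
... | b , inj₁ refl = prepend-triangles w₃ w₈ b
... | b , inj₂ refl = prepend-triangles w₃ w₁₀ b

InSomeBlowup-≥8 : ∀ {H p} → PermutationClosed H →
                  ClosedWalk H p 3 → ClosedWalk H p 8 → ClosedWalk H p 10 →
                  ∀ ℓ → 8 ≤ ℓ → ¬ 3 ∣ ℓ → InSomeBlowup (TightCycle ℓ) H
InSomeBlowup-≥8 closed w₃ w₈ w₁₀ ℓ 8≤ℓ 3∤ℓ =
  closedWalk⇒InSomeBlowup closed (≤-trans (s≤s (s≤s z≤n)) 8≤ℓ) (closedWalk-≥8 w₃ w₈ w₁₀ 8≤ℓ 3∤ℓ)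

around₄ : ClosedWalk (TightCycle 4) (# 0 , # 1) 4
around₄ = tightCycle-window (# 0) ∷ tightCycle-window (# 1) ∷ tightCycle-window (# 2)
        ∷ tightCycle-window (# 3) ∷ []

around₅ : ClosedWalk (TightCycle 5) (# 0 , # 1) 5
around₅ = tightCycle-window (# 0) ∷ tightCycle-window (# 1) ∷ tightCycle-window (# 2)
        ∷ tightCycle-window (# 3) ∷ tightCycle-window (# 4) ∷ []

triangle₄ : ClosedWalk (TightCycle 4) (# 0 , # 1) 3
triangle₄ = triangle (tightCycle-permutationClosed 3) (tightCycle-window (# 0))

triangle₅ : ClosedWalk (TightCycle 5) (# 0 , # 1) 3
triangle₅ = triangle (tightCycle-permutationClosed 4) (tightCycle-window (# 0))

F₁-walk : ClosedWalk F₁ (# 0 , # 1) 7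
F₁-walk = (fromList-edge (# 0) (# 1) (# 2) ∷ fromList-edge (# 1) (# 2) (# 3)
          ∷ fromList-edge (# 2) (# 3) (# 0) ∷ fromList-edge (# 3) (# 0) (# 1) ∷ [])
       ++ triangle (fromList-permutationClosed 5 _) (fromList-edge (# 0) (# 1) (# 2))

F₂-walk : ClosedWalk F₂ (# 0 , # 1) 7
F₂-walk = fromList-edge (# 0) (# 1) (# 2) ∷ fromList-edge (# 1) (# 2) (# 3)
        ∷ fromList-edge (# 2) (# 3) (# 0) ∷ fromList-edge (# 3) (# 0) (# 4)
        ∷ fromList-edge (# 0) (# 4) (# 5) ∷ fromList-edge (# 4) (# 5) (# 0)
        ∷ fromList-edge (# 5) (# 0) (# 1) ∷ []

claim2p3 : ((ℓ : ℕ) → 8 ≤ ℓ → ¬ (3 ∣ ℓ) →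
               InSomeBlowup (TightCycle ℓ) (TightCycle 4)
             × InSomeBlowup (TightCycle ℓ) (TightCycle 5))
           × (InSomeBlowup (TightCycle 7) (TightCycle 4)
             × InSomeBlowup (TightCycle 7) F₁
             × InSomeBlowup (TightCycle 7) F₂)
claim2p3 =
  (λ ℓ 8≤ℓ 3∤ℓ →
      InSomeBlowup-≥8 C₄-closed triangle₄ (around₄ ++ around₄) (around₄ ++ triangle₄ ++ triangle₄)
                      ℓ 8≤ℓ 3∤ℓ
    , InSomeBlowup-≥8 C₅-closed triangle₅ (around₅ ++ triangle₅) (around₅ ++ around₅)
                      ℓ 8≤ℓ 3∤ℓ)
  , closedWalk⇒InSomeBlowup C₄-closed 2≤7 (around₄ ++ triangle₄)
  , closedWalk⇒InSomeBlowup (fromList-permutationClosed 5 _) 2≤7 F₁-walk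
  , closedWalk⇒InSomeBlowup (fromList-permutationClosed 6 _) 2≤7 F₂-walk
  where
  C₄-closed : PermutationClosed (TightCycle 4)
  C₄-closed = tightCycle-permutationClosed 3
  C₅-closed : PermutationClosed (TightCycle 5)
  C₅-closed = tightCycle-permutationClosed 4
  2≤7 : 2 ≤ 7
  2≤7 = s≤s (s≤s z≤n)
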